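{- Let $G=(V,T,\tau)$ be a temporal graph, let $T_M$ be the set of all maximal span-trusses of $G$, and let $T_{inner}=\{T_{k^*}[G_\Delta]:\Delta\sqsubseteq T\}$ be the set of innermost trusses of all the static graphs $G_\Delta$. Then $T_M\subseteq T_{inner}$.
   Context: A temporal graph is $G=(V,T,\tau)$ where $V$ is a finite vertex set, $T=[0,1,\dots,t_{max}]\subseteq\mathbb{N}$ is a discrete time domain, and $\tau:V\times V\times T\to\{0,1\}$ specifies whether the (undirected) edge $(u,v)$ exists at time $t$. For $t\in T$ let $E_t=\{(u,v):\tau(u,v,t)=1\}$. A temporal interval $\Delta=[t_s,t_e]$ is contained in $\Delta'=[t'_s,t'_e]$, written $\Delta\sqsubseteq\Delta'$, if $t'_s\le t_s$ and $t'_e\ge t_e$. For an interval $\Delta\sqsubseteq T$, $E_\Delta=\bigcap_{t\in\Delta}E_t$ and $G_\Delta=(V,E_\Delta)$. For a static graph $H$ and $k\ge2$, the $k$-truss of $H$ is the largest (edge-induced) subgraph of $H$ in which every edge lies in at least $k-2$ triangles of that subgraph; the innermost truss $T_{k^*}[H]$ is the non-empty $k$-truss of $H$ with the largest $k$, and $k^*$ is its order. The $(k,\Delta)$-truss (span-truss) $T_{k,\Delta}$ of $G$ is the $k$-truss of $G_\Delta$. A span-truss $T_{k,\Delta}$ is maximal if there is no other span-truss $T_{k',\Delta'}$ of $G$ with $k\le k'$ and $\Delta\sqsubseteq\Delta'$. -}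

module Defs where

open import Data.Nat using (ℕ; _+_; _∸_; _≤_; _<_)
open import Data.Bool using (Bool; true; false; _∧_; if_then_else_)
open import Data.Fin using (Fin)
open import Data.List using (List; map; applyUpTo; allFin)
open import Data.Nat.ListAction using (sum)
open import Data.Bool.ListAction using (and)
open import Data.Product using (Σ; ∃; _×_; _,_)
open import Relation.Binary.PropositionalEquality using (_≡_)
open import Relation.Nullary using (¬_)

-- A temporal graph G = (V, T, τ) with V = Fin n and T = [0 .. tmax].
-- Edges are undirected and simple: τ is symmetric and has no self-loops.
record TemporalGraph : Set where
  field
    n     : ℕ
    tmax  : ℕ
    τ     : Fin n → Fin n → ℕ → Bool      -- only t ≤ tmax is relevant
    τ-sym : ∀ u v t → τ u v t ≡ τ v u t
    τ-irr : ∀ u t → τ u u t ≡ false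

open TemporalGraph public

EdgeSet : ℕ → Set
EdgeSet n = Fin n → Fin n → Bool

_⊆E_ : ∀ {n} → EdgeSet n → EdgeSet n → Set
S ⊆E S' = ∀ u v → S u v ≡ true → S' u v ≡ true

NonEmptyE : ∀ {n} → EdgeSet n → Set
NonEmptyE S = ∃ λ u → ∃ λ v → S u v ≡ true

EmptyE : ∀ {n} → EdgeSet n → Set
EmptyE S = ∀ u v → S u v ≡ false

support : ∀ {n} → EdgeSet n → Fin n → Fin n → ℕ
support {n} S u v = sum (map (λ w → if S u w ∧ S w v then 1 else 0) (allFin n))

TrussProp : ∀ {n} → ℕ → EdgeSet n → Set
TrussProp k S = ∀ u v → S u v ≡ true → k ∸ 2 ≤ support S u v

IsKTruss : ∀ {n} → EdgeSet n → ℕ → EdgeSet n → Set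
IsKTruss H k S =
  (S ⊆E H) × TrussProp k S × (∀ S' → S' ⊆E H → TrussProp k S' → S' ⊆E S)

IsInnermostTruss : ∀ {n} → EdgeSet n → EdgeSet n → Set
IsInnermostTruss H S =
  Σ ℕ λ k → (2 ≤ k) × IsKTruss H k S × NonEmptyE S ×
    (∀ k' → k < k' → ∀ S' → IsKTruss H k' S' → EmptyE S')

record Interval (G : TemporalGraph) : Set where
  constructor [_,_]⟨_,_⟩
  field
    ts    : ℕ
    te    : ℕ
    ts≤te : ts ≤ te
    te≤T  : te ≤ tmax G

open Interval public

_⊑_ : ∀ {G} → Interval G → Interval G → Set
Δ ⊑ Δ' = (ts Δ' ≤ ts Δ) × (te Δ ≤ te Δ')

allIn : (ℕ → Bool) → ℕ → ℕ → Bool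
allIn f s e = and (applyUpTo (λ i → f (s + i)) (1 + (e ∸ s)))

E[_] : (G : TemporalGraph) → Interval G → EdgeSet (n G)
E[ G ] Δ u v = allIn (τ G u v) (ts Δ) (te Δ)

IsSpanTruss : (G : TemporalGraph) → ℕ → Interval G → EdgeSet (n G) → Set
IsSpanTruss G k Δ S = (2 ≤ k) × IsKTruss (E[ G ] Δ) k S × NonEmptyE S

SameParams : ∀ {G} → ℕ → Interval G → ℕ → Interval G → Set
SameParams k Δ k' Δ' = (k ≡ k') × (ts Δ ≡ ts Δ') × (te Δ ≡ te Δ')

IsMaximalSpanTruss : (G : TemporalGraph) → ℕ → Interval G → EdgeSet (n G) → Set
IsMaximalSpanTruss G k Δ S =
  IsSpanTruss G k Δ S ×
  (∀ k' Δ' S' → k ≤ k' → Δ ⊑ Δ' → ¬ SameParams k Δ k' Δ' →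
     ¬ IsSpanTruss G k' Δ' S')

module Submission where

open import Defs
open import Data.Nat using (ℕ; _<_)
open import Data.Nat.Properties using (<⇒≤; <⇒≢; ≤-refl; ≤-trans)
open import Data.Product using (Σ; _,_; proj₁)
open import Data.Bool using (true; false)
open import Data.Empty using (⊥-elim)
open import Relation.Binary.PropositionalEquality using (refl)
open import Relation.Nullary using (¬_)

-- A maximal span-truss T_{k,Δ} is already the innermost truss of G_Δ itself:
-- a non-empty k'-truss of G_Δ with k < k' would be a span-truss dominating it.

¬nonEmptyE⇒emptyE : ∀ {m} (S : EdgeSet m) → ¬ NonEmptyE S → EmptyE S
¬nonEmptyE⇒emptyE S ¬ne u v with S u v in eq
... | false = refl
... | true  = ⊥-elim (¬ne (u , v , eq))

maximalSpanTruss-noLargerTruss : ∀ G k Δ S → IsMaximalSpanTruss G k Δ S →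
  ∀ k' → k < k' → ∀ S' → IsKTruss (E[ G ] Δ) k' S' → ¬ NonEmptyE S'
maximalSpanTruss-noLargerTruss G k Δ S ((2≤k , _ , _) , maximal) k' k<k' S' truss' ne' =
  maximal k' Δ S' (<⇒≤ k<k') (≤-refl , ≤-refl)
    (λ same → <⇒≢ k<k' (proj₁ same))
    (≤-trans 2≤k (<⇒≤ k<k') , truss' , ne')

maximalSpanTruss-isInnermostTruss : ∀ G k Δ S →
  IsMaximalSpanTruss G k Δ S → IsInnermostTruss (E[ G ] Δ) S
maximalSpanTruss-isInnermostTruss G k Δ S max@((2≤k , truss , ne) , _) =
  k , 2≤k , truss , ne ,
  λ k' k<k' S' truss' →
    ¬nonEmptyE⇒emptyE S' (maximalSpanTruss-noLargerTruss G k Δ S max k' k<k' S' truss')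

lemma3p5 : (G : TemporalGraph) (k : ℕ) (Δ : Interval G) (S : EdgeSet (n G)) →
    IsMaximalSpanTruss G k Δ S → Σ (Interval G) (λ Δ' → IsInnermostTruss (E[ G ] Δ') S)
lemma3p5 G k Δ S max = Δ , maximalSpanTruss-isInnermostTruss G k Δ S max
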